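{- Let $m_1,\dots,m_t$ be $n$-variable monomials of degree $k$. Then $\bigcap_{i=1}^tN_k(m_i)=\{U\in\mathcal{U}_{n,k}:\ \mathrm{rank}(G_U[\mathrm{Var}(m_i)])=k\text{ for all }i\in[t]\}$.
   Context: $\mathcal{U}_{n,k}$ is the set of $k$-dimensional linear subspaces of $\mathbb{F}_2^n$. For $U\in\mathcal{U}_{n,k}$, $G_U$ is the unique $k\times n$ rank-$k$ matrix over $\mathbb{F}_2$ in reduced row echelon form whose rows span $U$; for $I\subseteq[n]$, $G_U[I]$ is its submatrix of columns indexed by $I$. For a monomial $m=\prod_{i\in I}x_i$, $\mathrm{Var}(m)=I$. $N_k(m)$ is the set of $U\in\mathcal{U}_{n,k}$ with $\sum_{x\in U}m(x)\neq0$. Ranks over $\mathbb{F}_2$. -}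

module Defs where

open import Data.Bool using (Bool; true; false; _∧_; _xor_; not; if_then_else_)
open import Data.Nat using (ℕ; zero; suc; _<_; _⊔_)
open import Data.Fin using (Fin; toℕ)
open import Data.Fin.Subset using (Subset)
open import Data.Vec using (Vec; []; _∷_; lookup; replicate; zipWith; toList)
open import Data.List using (List; []; _∷_; map; filter; foldr; length; _++_; concatMap)
open import Data.Product using (Σ; _×_; _,_)
open import Relation.Binary.PropositionalEquality using (_≡_; _≢_)
open import Relation.Nullary using (¬_)
open import Data.Vec.Properties using (≡-dec)
open import Data.Bool.Properties using () renaming (_≟_ to _≟ᵇ_)
open import Relation.Nullary.Decidable using (⌊_⌋)

-- The field F₂ is Bool with addition _xor_ and multiplication _∧_.
-- Vectors of F₂ⁿ are Vec Bool n.

F2ⁿ : ℕ → Set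
F2ⁿ n = Vec Bool n

zeroV : ∀ {n} → F2ⁿ n
zeroV = replicate _ false

_⊕_ : ∀ {n} → F2ⁿ n → F2ⁿ n → F2ⁿ n
_⊕_ = zipWith _xor_

_≟V_ : ∀ {n} (x y : F2ⁿ n) → _
_≟V_ = ≡-dec _≟ᵇ_

allVecs : (n : ℕ) → List (F2ⁿ n)
allVecs zero = [] ∷ []
allVecs (suc n) = map (false ∷_) (allVecs n) ++ map (true ∷_) (allVecs n)

Matrix : ℕ → ℕ → Set
Matrix k n = Vec (F2ⁿ n) k

combine : ∀ {k n} → F2ⁿ k → Matrix k n → F2ⁿ n
combine [] [] = zeroV
combine (c ∷ cs) (r ∷ rs) = (if c then r else zeroV) ⊕ combine cs rs

_∈RowSpan_ : ∀ {k n} → F2ⁿ n → Matrix k n → Set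
_∈RowSpan_ {k} x G = Σ (F2ⁿ k) λ c → combine c G ≡ x

column : ∀ {k n} → Matrix k n → Fin n → F2ⁿ k
column [] j = []
column (r ∷ rs) j = lookup r j ∷ column rs j

-- G[I] : the submatrix of columns indexed by I (in increasing order),
-- represented as the list of its columns.
subColumns : ∀ {k n} → Matrix k n → Subset n → List (F2ⁿ k)
subColumns {n = zero} G [] = []
subColumns {n = suc n} G (b ∷ I) =
  let rest = subColumns (Data.Vec.map Data.Vec.tail G) I in
  if b then column G Data.Fin.zero ∷ rest else rest

allColumns : ∀ {k n} → Matrix k n → List (F2ⁿ k)
allColumns {n = n} G = subColumns G (replicate n true)

subseqs : ∀ {A : Set} → List A → List (List A)
subseqs [] = [] ∷ []
subseqs (x ∷ xs) = subseqs xs ++ map (x ∷_) (subseqs xs)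

sumV : ∀ {r} → List (F2ⁿ r) → F2ⁿ r
sumV = foldr _⊕_ zeroV

isNonEmpty : ∀ {A : Set} → List A → Bool
isNonEmpty [] = false
isNonEmpty (_ ∷ _) = true

andL : List Bool → Bool
andL = foldr _∧_ true

-- A family of vectors over F₂ is linearly independent iff no nonempty
-- subfamily (= nontrivial F₂-linear combination) sums to 0.
independent : ∀ {r} → List (F2ⁿ r) → Bool
independent vs =
  andL (map (λ s → if isNonEmpty s then not ⌊ sumV s ≟V zeroV ⌋ else true) (subseqs vs))

maxL : List ℕ → ℕ
maxL = foldr _⊔_ 0

rank : ∀ {r} → List (F2ⁿ r) → ℕ
rank cols = maxL (map length (filter (λ s → independent s Data.Bool.≟ true) (subseqs cols)))

IsRREF : ∀ {k n} → Matrix k n → Set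
IsRREF {k} {n} G =
  Σ (Vec (Fin n) k) λ p →
    (∀ (i : Fin k) (j : Fin n) → toℕ j < toℕ (lookup p i) → lookup (lookup G i) j ≡ false)
    × (∀ (i : Fin k) → lookup (lookup G i) (lookup p i) ≡ true)
    × (∀ (i i' : Fin k) → i ≢ i' → lookup (lookup G i') (lookup p i) ≡ false)
    × (∀ (i i' : Fin k) → toℕ i < toℕ i' → toℕ (lookup p i) < toℕ (lookup p i'))

-- A monomial m = ∏_{i ∈ I} x_i in n variables, represented by its
-- variable set Var(m) = I ⊆ [n].
Monomial : ℕ → Set
Monomial n = Subset n

Var : ∀ {n} → Monomial n → Subset n
Var m = m

evalMon : ∀ {n} → Monomial n → F2ⁿ n → Bool
evalMon [] [] = true
evalMon (b ∷ m) (x ∷ xs) = (if b then x else true) ∧ evalMon m xs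

sumOver : ∀ {n} → (F2ⁿ n → Bool) → Monomial n → Bool
sumOver {n} U m = foldr _xor_ false (map (evalMon m) (filter (λ x → U x Data.Bool.≟ true) (allVecs n)))

-- Since G is in reduced row echelon form, c ↦ c G enumerates U without repetition, so
-- Σ_{x ∈ U} m(x) = Σ_{c ∈ F₂ᵏ} ∏_{j ∈ Var m} (c · g_j), where the g_j are the columns of G[Var m].
-- As |Var m| = k, the summand is the indicator of ψ(c) = (1,…,1) for the linear map
-- ψ(c) = (c · g_j)_j on F₂ᵏ. If ψ has a nonzero kernel vector d, the summand is invariant under
-- c ↦ c + d, so the terms cancel in pairs and the sum is 0; if ψ is injective it is bijective,
-- and exactly one term is 1. Finally ψ is the transpose of G[Var m], so it is injective iff the
-- columns of G[Var m] are independent, i.e. iff rank G[Var m] = k.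

{-# OPTIONS --safe #-}
module Submission where

open import Defs
open import Algebra using (CommutativeRing)
open import Data.Bool using (Bool; true; false; not; _∧_; _xor_; if_then_else_; _≟_)
open import Data.Bool.Properties
  using ( xor-assoc; xor-comm; xor-same; xor-identityʳ; ∧-identityʳ; ∧-zeroʳ
        ; ∧-distribˡ-xor; ∧-distribʳ-xor; ¬-not; T-≡; ≡-setoid; xor-∧-commutativeRing)
open import Data.Fin using (Fin; zero; suc)
open import Data.Fin.Properties using (suc-injective)
open import Data.Fin.Subset using (Subset; ∣_∣)
open import Data.List as List using (List; []; _∷_; _++_; length; filter)
open import Data.List.Membership.Propositional using (_∈_; lose)
open import Data.List.Membership.Propositional.Properties
  using ( ∈-map⁺; ∈-map⁻; ∈-++⁺ˡ; ∈-++⁺ʳ; ∈-++⁻; ∈-∃++; ∈-filter⁺; ∈-filter⁻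
        ; foldr-selective)
open import Data.List.Membership.Propositional.Properties.WithK using (unique∧set⇒bag)
open import Data.List.Properties
  using ( map-cong; map-∘; map-++; length-map; length-++-sucʳ; filter-notAll
        ; foldr-forcesᵇ; foldr-preservesᵇ)
open import Data.List.Relation.Binary.BagAndSetEquality using (∼bag⇒↭)
open import Data.List.Relation.Binary.Equality.Propositional using (≋⇒≡)
open import Data.List.Relation.Binary.Permutation.Propositional using (_↭_; ↭⇒↭ₛ)
import Data.List.Relation.Binary.Permutation.Propositional.Properties as ↭
open import Data.List.Relation.Binary.Permutation.Setoid.Properties ≡-setoid using (foldr-commMonoid)
open import Data.List.Relation.Binary.Subset.Propositional using (_⊆_)
open import Data.List.Relation.Binary.Sublist.Propositional as Sublist using ([]; _∷_; _∷ʳ_)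
open import Data.List.Relation.Binary.Sublist.Propositional.Properties using (length-mono-≤; to-≋)
import Data.List.Relation.Unary.All as All
open import Data.List.Relation.Unary.All.Properties using (all⁺; all⁻)
open import Data.List.Relation.Unary.AllPairs using ([]; _∷_)
open import Data.List.Relation.Unary.Any using (here; there; satisfied; any?)
open import Data.List.Relation.Unary.Unique.Propositional using (Unique)
import Data.List.Relation.Unary.Unique.Propositional.Properties as Unique
open import Data.Nat using (ℕ; zero; suc; _≤_; _<_; z≤n; s≤s)
open import Data.Nat.Properties
  using (≤-refl; ≤-antisym; ≤-<-trans; <-irrefl; ⊔-sel; ⊔-lub; m⊔n≤o⇒m≤o; m⊔n≤o⇒n≤o)
open import Data.Product as Product using (∃; _×_; _,_; proj₁; proj₂)
open import Data.Sum using (inj₁; inj₂)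
open import Data.Vec as Vec using (Vec; []; _∷_; lookup; replicate)
open import Data.Vec.Properties
  using ( ∷-injectiveʳ; zipWith-assoc; zipWith-identityˡ; zipWith-identityʳ
        ; tabulate∘lookup; tabulate-cong; lookup-replicate)
open import Function using (_∘_; id)
open import Function.Bundles using (_⇔_; mk⇔; Equivalence)
open import Function.Definitions using (Injective; StrictlySurjective)
import Function.Related.Propositional as Related
open import Relation.Binary.PropositionalEquality
open import Relation.Nullary using (¬_; yes; no; ¬?; contradiction)
open import Relation.Nullary.Decidable using (⌊_⌋)
open import Algebra.Properties.CommutativeSemigroup
  (CommutativeRing.+-commutativeSemigroup xor-∧-commutativeRing)
  using () renaming (interchange to xor-interchange)

private
  variable
    A : Set
    r s k n : ℕ

-- Linear algebra over F₂

⊕-assoc : (x y z : F2ⁿ r) → (x ⊕ y) ⊕ z ≡ x ⊕ (y ⊕ z)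
⊕-assoc = zipWith-assoc xor-assoc

⊕-identityˡ : (x : F2ⁿ r) → zeroV ⊕ x ≡ x
⊕-identityˡ = zipWith-identityˡ (λ _ → refl)

⊕-identityʳ : (x : F2ⁿ r) → x ⊕ zeroV ≡ x
⊕-identityʳ = zipWith-identityʳ xor-identityʳ

⊕-same : (x : F2ⁿ r) → x ⊕ x ≡ zeroV
⊕-same []      = refl
⊕-same (b ∷ x) = cong₂ _∷_ (xor-same b) (⊕-same x)

⊕-interchange : (w x y z : F2ⁿ r) → (w ⊕ x) ⊕ (y ⊕ z) ≡ (w ⊕ y) ⊕ (x ⊕ z)
⊕-interchange []      []      []      []      = refl
⊕-interchange (a ∷ w) (b ∷ x) (c ∷ y) (d ∷ z) =
  cong₂ _∷_ (xor-interchange a b c d) (⊕-interchange w x y z)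

⊕≡zeroV⇒≡ : {x y : F2ⁿ r} → x ⊕ y ≡ zeroV → x ≡ y
⊕≡zeroV⇒≡ {x = x} {y} x⊕y≡0 = begin
  x            ≡⟨ ⊕-identityʳ x ⟨
  x ⊕ zeroV    ≡⟨ cong (x ⊕_) (⊕-same y) ⟨
  x ⊕ (y ⊕ y)  ≡⟨ ⊕-assoc x y y ⟨
  (x ⊕ y) ⊕ y  ≡⟨ cong (_⊕ y) x⊕y≡0 ⟩
  zeroV ⊕ y    ≡⟨ ⊕-identityˡ y ⟩
  y            ∎
  where open ≡-Reasoning

lookup-ext : {u v : Vec A n} → (∀ i → lookup u i ≡ lookup v i) → u ≡ v
lookup-ext {u = u} {v} u≗v =
  trans (sym (tabulate∘lookup u)) (trans (tabulate-cong u≗v) (tabulate∘lookup v))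

IsLinear : (F2ⁿ r → F2ⁿ s) → Set
IsLinear f = ∀ x y → f (x ⊕ y) ≡ f x ⊕ f y

linear-⊕∈kernel : {f : F2ⁿ r → F2ⁿ s} → IsLinear f →
  ∀ {x y} → f x ≡ f y → f (x ⊕ y) ≡ zeroV
linear-⊕∈kernel {f = f} lin {x} {y} fx≡fy =
  trans (lin x y) (trans (cong (_⊕ f y) fx≡fy) (⊕-same (f y)))

linear∧trivialKernel⇒injective : {f : F2ⁿ r → F2ⁿ s} → IsLinear f →
  (∀ x → f x ≡ zeroV → x ≡ zeroV) → Injective _≡_ _≡_ f
linear∧trivialKernel⇒injective lin ker fx≡fy = ⊕≡zeroV⇒≡ (ker _ (linear-⊕∈kernel lin fx≡fy))

dot : F2ⁿ r → F2ⁿ r → Bool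
dot []       []       = false
dot (a ∷ as) (b ∷ bs) = (a ∧ b) xor dot as bs

dot-zeroʳ : (c : F2ⁿ r) → dot c zeroV ≡ false
dot-zeroʳ []      = refl
dot-zeroʳ (a ∷ c) = cong₂ _xor_ (∧-zeroʳ a) (dot-zeroʳ c)

dot-⊕ʳ : (c x y : F2ⁿ r) → dot c (x ⊕ y) ≡ dot c x xor dot c y
dot-⊕ʳ []      []      []      = refl
dot-⊕ʳ (a ∷ c) (b ∷ x) (d ∷ y) = begin
  (a ∧ (b xor d)) xor dot c (x ⊕ y)
    ≡⟨ cong₂ _xor_ (∧-distribˡ-xor a b d) (dot-⊕ʳ c x y) ⟩
  ((a ∧ b) xor (a ∧ d)) xor (dot c x xor dot c y)
    ≡⟨ xor-interchange (a ∧ b) (a ∧ d) (dot c x) (dot c y) ⟩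
  ((a ∧ b) xor dot c x) xor ((a ∧ d) xor dot c y)
    ∎
  where open ≡-Reasoning

dot-⊕ˡ : (x y v : F2ⁿ r) → dot (x ⊕ y) v ≡ dot x v xor dot y v
dot-⊕ˡ []      []      []      = refl
dot-⊕ˡ (a ∷ x) (b ∷ y) (d ∷ v) = begin
  ((a xor b) ∧ d) xor dot (x ⊕ y) v
    ≡⟨ cong₂ _xor_ (∧-distribʳ-xor d a b) (dot-⊕ˡ x y v) ⟩
  ((a ∧ d) xor (b ∧ d)) xor (dot x v xor dot y v)
    ≡⟨ xor-interchange (a ∧ d) (b ∧ d) (dot x v) (dot y v) ⟩
  ((a ∧ d) xor dot x v) xor ((b ∧ d) xor dot y v)
    ∎
  where open ≡-Reasoning

orthogonal-to-all⇒≡zeroV : (w : F2ⁿ r) → (∀ e → dot w e ≡ false) → w ≡ zeroV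
orthogonal-to-all⇒≡zeroV []          _     = refl
orthogonal-to-all⇒≡zeroV (true ∷ w)  w⊥all
  with () ← trans (sym (cong (true xor_) (dot-zeroʳ w))) (w⊥all (true ∷ zeroV))
orthogonal-to-all⇒≡zeroV (false ∷ w) w⊥all =
  cong (false ∷_) (orthogonal-to-all⇒≡zeroV w (λ e → w⊥all (false ∷ e)))

adjoint-surjective⇒trivialKernel : {f : F2ⁿ s → F2ⁿ r} {g : F2ⁿ r → F2ⁿ s} →
  (∀ x y → dot x (f y) ≡ dot y (g x)) → StrictlySurjective _≡_ g →
  ∀ y → f y ≡ zeroV → y ≡ zeroV
adjoint-surjective⇒trivialKernel {f = f} {g} adjoint g-onto y fy≡0 =
  orthogonal-to-all⇒≡zeroV y y⊥all
  where
  y⊥all : ∀ e → dot y e ≡ false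
  y⊥all e with x , refl ← g-onto e = begin
    dot y (g x)  ≡⟨ adjoint x y ⟨
    dot x (f y)  ≡⟨ cong (dot x) fy≡0 ⟩
    dot x zeroV  ≡⟨ dot-zeroʳ x ⟩
    false        ∎
    where open ≡-Reasoning

scale-xor : (a b : Bool) (v : F2ⁿ r) →
  (if a xor b then v else zeroV) ≡ (if a then v else zeroV) ⊕ (if b then v else zeroV)
scale-xor false false v = sym (⊕-identityˡ zeroV)
scale-xor false true  v = sym (⊕-identityˡ v)
scale-xor true  false v = sym (⊕-identityʳ v)
scale-xor true  true  v = sym (⊕-same v)

combine-linear : (M : Matrix s r) → IsLinear (λ c → combine c M)
combine-linear []      []      []      = sym (⊕-identityˡ zeroV)
combine-linear (v ∷ M) (a ∷ c) (b ∷ d) = begin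
  (if a xor b then v else zeroV) ⊕ combine (c ⊕ d) M
    ≡⟨ cong₂ _⊕_ (scale-xor a b v) (combine-linear M c d) ⟩
  (av ⊕ bv) ⊕ (combine c M ⊕ combine d M)
    ≡⟨ ⊕-interchange av bv (combine c M) (combine d M) ⟩
  (av ⊕ combine c M) ⊕ (bv ⊕ combine d M)
    ∎
  where
  open ≡-Reasoning
  av = if a then v else zeroV
  bv = if b then v else zeroV

map-dot-linear : (M : Matrix s r) → IsLinear (λ c → Vec.map (dot c) M)
map-dot-linear []      x y = refl
map-dot-linear (v ∷ M) x y = cong₂ _∷_ (dot-⊕ˡ x y v) (map-dot-linear M x y)

dot-combine : (c : F2ⁿ r) (d : F2ⁿ s) (M : Matrix s r) →
  dot c (combine d M) ≡ dot d (Vec.map (dot c) M)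
dot-combine c []          []      = dot-zeroʳ c
dot-combine c (true ∷ d)  (v ∷ M) =
  trans (dot-⊕ʳ c v (combine d M)) (cong (dot c v xor_) (dot-combine c d M))
dot-combine c (false ∷ d) (v ∷ M) =
  trans (cong (dot c) (⊕-identityˡ (combine d M))) (dot-combine c d M)

IndependentRows : Matrix s r → Set
IndependentRows M = ∀ d → combine d M ≡ zeroV → d ≡ zeroV

-- Enumerating F₂ʳ

∈-allVecs : (x : F2ⁿ r) → x ∈ allVecs r
∈-allVecs []                 = here refl
∈-allVecs (false ∷ x)        = ∈-++⁺ˡ (∈-map⁺ (false ∷_) (∈-allVecs x))
∈-allVecs {suc r} (true ∷ x) =
  ∈-++⁺ʳ (List.map (false ∷_) (allVecs r)) (∈-map⁺ (true ∷_) (∈-allVecs x))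

allVecs-unique : (r : ℕ) → Unique (allVecs r)
allVecs-unique zero    = All.[] ∷ []
allVecs-unique (suc r) =
  Unique.++⁺ (Unique.map⁺ ∷-injectiveʳ (allVecs-unique r))
             (Unique.map⁺ ∷-injectiveʳ (allVecs-unique r))
             disjoint
  where
  disjoint : ∀ {v} → ¬ (v ∈ List.map (false ∷_) (allVecs r) × v ∈ List.map (true ∷_) (allVecs r))
  disjoint (v∈₀ , v∈₁)
    with _ , _ , refl ← ∈-map⁻ (false ∷_) v∈₀ | _ , _ , () ← ∈-map⁻ (true ∷_) v∈₁

unique∧⊆⇒length≤ : {xs ys : List A} → Unique xs → xs ⊆ ys → length xs ≤ length ys
unique∧⊆⇒length≤ {xs = []}     _              _     = z≤n
unique∧⊆⇒length≤ {xs = x ∷ xs} (x∉xs ∷ uniq) x∷xs⊆ys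
  with ys₁ , ys₂ , refl ← ∈-∃++ (x∷xs⊆ys (here refl)) =
  subst (suc (length xs) ≤_) (sym (length-++-sucʳ ys₁ x ys₂))
    (s≤s (unique∧⊆⇒length≤ uniq xs⊆ys₁ys₂))
  where
  xs⊆ys₁ys₂ : xs ⊆ ys₁ ++ ys₂
  xs⊆ys₁ys₂ {z} z∈xs with ∈-++⁻ ys₁ (x∷xs⊆ys (there z∈xs))
  ... | inj₁ z∈ys₁         = ∈-++⁺ˡ z∈ys₁
  ... | inj₂ (here z≡x)    = contradiction (sym z≡x) (All.lookup x∉xs z∈xs)
  ... | inj₂ (there z∈ys₂) = ∈-++⁺ʳ ys₁ z∈ys₂

-- Pigeonhole: if y were missed, the 2ʳ distinct values f x would fit among the 2ʳ − 1 vectors ≠ y.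
injective⇒surjective : (f : F2ⁿ r → F2ⁿ r) → Injective _≡_ _≡_ f → StrictlySurjective _≡_ f
injective⇒surjective {r} f f-inj y with any? (λ x → f x ≟V y) (allVecs r)
... | yes y∈image = satisfied y∈image
... | no  y∉image = contradiction (≤-<-trans image≤others others<all) (<-irrefl refl)
  where
  others = filter (λ z → ¬? (z ≟V y)) (allVecs r)
  image⊆others : List.map f (allVecs r) ⊆ others
  image⊆others z∈image with x , _ , refl ← ∈-map⁻ f z∈image =
    ∈-filter⁺ (λ z → ¬? (z ≟V y)) (∈-allVecs (f x))
      (λ fx≡y → y∉image (lose (∈-allVecs x) fx≡y))
  image≤others : length (allVecs r) ≤ length others
  image≤others = subst (_≤ length others) (length-map f (allVecs r))
    (unique∧⊆⇒length≤ (Unique.map⁺ f-inj (allVecs-unique r)) image⊆others)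
  others<all : length others < length (allVecs r)
  others<all = filter-notAll (λ z → ¬? (z ≟V y)) (allVecs r) (lose (∈-allVecs y) (λ y≢y → y≢y refl))

-- Sums over F₂ʳ

parity : List Bool → Bool
parity = List.foldr _xor_ false

∑ : (r : ℕ) → (F2ⁿ r → Bool) → Bool
∑ r g = parity (List.map g (allVecs r))

parity-++ : (xs ys : List Bool) → parity (xs ++ ys) ≡ parity xs xor parity ys
parity-++ []       ys = refl
parity-++ (x ∷ xs) ys =
  trans (cong (x xor_) (parity-++ xs ys)) (sym (xor-assoc x (parity xs) (parity ys)))

parity-↭ : {xs ys : List Bool} → xs ↭ ys → parity xs ≡ parity ys
parity-↭ xs↭ys =
  foldr-commMonoid (CommutativeRing.+-isCommutativeMonoid xor-∧-commutativeRing) (↭⇒↭ₛ xs↭ys)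

∑-cong : {g h : F2ⁿ r → Bool} → (∀ c → g c ≡ h c) → ∑ r g ≡ ∑ r h
∑-cong g≗h = cong parity (map-cong g≗h (allVecs _))

∑-suc : (g : F2ⁿ (suc r) → Bool) → ∑ (suc r) g ≡ ∑ r (g ∘ (false ∷_)) xor ∑ r (g ∘ (true ∷_))
∑-suc {r} g = begin
  parity (List.map g (false∷cs ++ true∷cs))
    ≡⟨ cong parity (map-++ g false∷cs true∷cs) ⟩
  parity (List.map g false∷cs ++ List.map g true∷cs)
    ≡⟨ parity-++ (List.map g false∷cs) (List.map g true∷cs) ⟩
  parity (List.map g false∷cs) xor parity (List.map g true∷cs)
    ≡⟨ cong₂ _xor_ (cong parity (map-∘ (allVecs r))) (cong parity (map-∘ (allVecs r))) ⟨
  ∑ r (g ∘ (false ∷_)) xor ∑ r (g ∘ (true ∷_))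
    ∎
  where
  open ≡-Reasoning
  false∷cs = List.map (false ∷_) (allVecs r)
  true∷cs  = List.map (true ∷_) (allVecs r)

∑-translate : (g : F2ⁿ r → Bool) (d : F2ⁿ r) → ∑ r (λ c → g (c ⊕ d)) ≡ ∑ r g
∑-translate {zero}  g []          = refl
∑-translate {suc r} g (false ∷ d) =
  trans (∑-suc (λ c → g (c ⊕ (false ∷ d))))
    (trans (cong₂ _xor_ (∑-translate (g ∘ (false ∷_)) d) (∑-translate (g ∘ (true ∷_)) d))
      (sym (∑-suc g)))
∑-translate {suc r} g (true ∷ d)  =
  trans (∑-suc (λ c → g (c ⊕ (true ∷ d))))
    (trans (cong₂ _xor_ (∑-translate (g ∘ (true ∷_)) d) (∑-translate (g ∘ (false ∷_)) d))
      (trans (xor-comm (∑ r (g ∘ (true ∷_))) (∑ r (g ∘ (false ∷_)))) (sym (∑-suc g))))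

∑-periodic : (g : F2ⁿ r → Bool) {d : F2ⁿ r} →
  d ≢ zeroV → (∀ c → g (c ⊕ d) ≡ g c) → ∑ r g ≡ false
∑-periodic {zero}  g {[]}        d≢0 _        = contradiction refl d≢0
∑-periodic {suc r} g {false ∷ d} d≢0 periodic =
  trans (∑-suc g) (cong₂ _xor_ (∑-periodic (g ∘ (false ∷_)) d′≢0 (periodic ∘ (false ∷_)))
                               (∑-periodic (g ∘ (true ∷_)) d′≢0 (periodic ∘ (true ∷_))))
  where
  d′≢0 : d ≢ zeroV
  d′≢0 = d≢0 ∘ cong (false ∷_)
∑-periodic {suc r} g {true ∷ d}  d≢0 periodic = begin
  ∑ (suc r) g                          ≡⟨ ∑-suc g ⟩
  s₀ xor ∑ r (g ∘ (true ∷_))           ≡⟨ cong (s₀ xor_) (∑-translate (g ∘ (true ∷_)) d) ⟨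
  s₀ xor ∑ r (λ c → g (true ∷ c ⊕ d))  ≡⟨ cong (s₀ xor_) (∑-cong (periodic ∘ (false ∷_))) ⟩
  s₀ xor s₀                            ≡⟨ xor-same s₀ ⟩
  false                                ∎
  where
  open ≡-Reasoning
  s₀ = ∑ r (g ∘ (false ∷_))

∑-false : (g : F2ⁿ r → Bool) → (∀ c → g c ≡ false) → ∑ r g ≡ false
∑-false {zero}  g g≡false = cong (_xor false) (g≡false [])
∑-false {suc r} g g≡false =
  trans (∑-suc g) (cong₂ _xor_ (∑-false (g ∘ (false ∷_)) (g≡false ∘ (false ∷_)))
                               (∑-false (g ∘ (true ∷_)) (g≡false ∘ (true ∷_))))

∑-indicator : (g : F2ⁿ r → Bool) (c₀ : F2ⁿ r) →
  g c₀ ≡ true → (∀ c → g c ≡ true → c ≡ c₀) → ∑ r g ≡ true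
∑-indicator {zero}  g []           gc₀ _    = cong (_xor false) gc₀
∑-indicator {suc r} g (false ∷ c₀) gc₀ only =
  trans (∑-suc g) (cong₂ _xor_
    (∑-indicator (g ∘ (false ∷_)) c₀ gc₀ (λ c gc → ∷-injectiveʳ (only (false ∷ c) gc)))
    (∑-false (g ∘ (true ∷_)) (λ c → ¬-not (λ gc → contradiction (only (true ∷ c) gc) λ ()))))
∑-indicator {suc r} g (true ∷ c₀)  gc₀ only =
  trans (∑-suc g) (cong₂ _xor_
    (∑-false (g ∘ (false ∷_)) (λ c → ¬-not (λ gc → contradiction (only (false ∷ c) gc) λ ())))
    (∑-indicator (g ∘ (true ∷_)) c₀ gc₀ (λ c gc → ∷-injectiveʳ (only (true ∷ c) gc))))

∑-∘-linear≡true⇒injective : {f : F2ⁿ r → F2ⁿ s} (g : F2ⁿ s → Bool) → IsLinear f →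
  ∑ r (g ∘ f) ≡ true → Injective _≡_ _≡_ f
∑-∘-linear≡true⇒injective {f = f} g lin ∑≡true {x} {y} fx≡fy with x ≟V y
... | yes x≡y = x≡y
... | no  x≢y =
  contradiction (trans (sym ∑≡true) (∑-periodic (g ∘ f) (x≢y ∘ ⊕≡zeroV⇒≡) periodic)) λ ()
  where
  periodic : ∀ c → g (f (c ⊕ (x ⊕ y))) ≡ g (f c)
  periodic c = cong g (begin
    f (c ⊕ (x ⊕ y))  ≡⟨ lin c (x ⊕ y) ⟩
    f c ⊕ f (x ⊕ y)  ≡⟨ cong (f c ⊕_) (linear-⊕∈kernel lin fx≡fy) ⟩
    f c ⊕ zeroV      ≡⟨ ⊕-identityʳ (f c) ⟩
    f c              ∎)
    where open ≡-Reasoning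

∑-∘-injective≡true : (f : F2ⁿ r → F2ⁿ r) {g : F2ⁿ r → Bool} {y : F2ⁿ r} →
  Injective _≡_ _≡_ f → g y ≡ true → (∀ z → g z ≡ true → z ≡ y) → ∑ r (g ∘ f) ≡ true
∑-∘-injective≡true f {g} {y} f-inj gy≡true only-y
  with c₀ , refl ← injective⇒surjective f f-inj y =
  ∑-indicator (g ∘ f) c₀ gy≡true (λ c gfc≡true → f-inj (only-y (f c) gfc≡true))

allTrue : Vec Bool s → Bool
allTrue = Vec.foldr′ _∧_ true

allTrue-replicate : (s : ℕ) → allTrue (replicate s true) ≡ true
allTrue-replicate zero    = refl
allTrue-replicate (suc s) = allTrue-replicate s

allTrue⇒≡replicate : (v : Vec Bool s) → allTrue v ≡ true → v ≡ replicate s true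
allTrue⇒≡replicate []          _  = refl
allTrue⇒≡replicate (true ∷ v) all = cong (true ∷_) (allTrue⇒≡replicate v all)

∑-allTrue⇔IndependentRows : (M : Matrix s r) → s ≡ r →
  (∑ r (λ c → allTrue (Vec.map (dot c) M)) ≡ true) ⇔ IndependentRows M
∑-allTrue⇔IndependentRows {s} M refl = mk⇔ to from
  where
  to : ∑ s (λ c → allTrue (Vec.map (dot c) M)) ≡ true → IndependentRows M
  to ∑≡true = adjoint-surjective⇒trivialKernel (λ c d → dot-combine c d M)
    (injective⇒surjective _ (∑-∘-linear≡true⇒injective allTrue (map-dot-linear M) ∑≡true))
  from : IndependentRows M → ∑ s (λ c → allTrue (Vec.map (dot c) M)) ≡ true
  from rows-indep =
    ∑-∘-injective≡true _ map-dot-injective (allTrue-replicate s) allTrue⇒≡replicate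
    where
    combine-onto : StrictlySurjective _≡_ (λ d → combine d M)
    combine-onto =
      injective⇒surjective _ (linear∧trivialKernel⇒injective (combine-linear M) rows-indep)
    map-dot-injective : Injective _≡_ _≡_ (λ c → Vec.map (dot c) M)
    map-dot-injective = linear∧trivialKernel⇒injective (map-dot-linear M)
      (adjoint-surjective⇒trivialKernel (λ d c → sym (dot-combine c d M)) combine-onto)

-- Subfamilies, independence and rank

and-map≡allTrue : (p : A → Bool) (xs : List A) →
  andL (List.map p xs) ≡ allTrue (Vec.map p (Vec.fromList xs))
and-map≡allTrue p []       = refl
and-map≡allTrue p (x ∷ xs) = cong (p x ∧_) (and-map≡allTrue p xs)

and-map≡true⇔ : (p : A → Bool) (xs : List A) →
  andL (List.map p xs) ≡ true ⇔ (∀ {x} → x ∈ xs → p x ≡ true)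
and-map≡true⇔ p xs = mk⇔ to from
  where
  to : andL (List.map p xs) ≡ true → ∀ {x} → x ∈ xs → p x ≡ true
  to and≡true = Equivalence.to T-≡ ∘ All.lookup (all⁺ p xs (Equivalence.from T-≡ and≡true))
  from : (∀ {x} → x ∈ xs → p x ≡ true) → andL (List.map p xs) ≡ true
  from all-true = Equivalence.to T-≡ (all⁻ p (All.tabulate (Equivalence.from T-≡ ∘ all-true)))

select : (xs : List A) → Vec Bool (length xs) → List A
select []       []          = []
select (x ∷ xs) (true ∷ d)  = x ∷ select xs d
select (x ∷ xs) (false ∷ d) = select xs d

∈-subseqs⁺ : (xs : List A) (d : Vec Bool (length xs)) → select xs d ∈ subseqs xs
∈-subseqs⁺ []       []          = here refl
∈-subseqs⁺ (x ∷ xs) (true ∷ d)  = ∈-++⁺ʳ (subseqs xs) (∈-map⁺ (x ∷_) (∈-subseqs⁺ xs d))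
∈-subseqs⁺ (x ∷ xs) (false ∷ d) = ∈-++⁺ˡ (∈-subseqs⁺ xs d)

∈-subseqs⁻ : (xs : List A) {ys : List A} → ys ∈ subseqs xs → ∃ λ d → select xs d ≡ ys
∈-subseqs⁻ []       (here refl) = [] , refl
∈-subseqs⁻ (x ∷ xs) ys∈ with ∈-++⁻ (subseqs xs) ys∈
... | inj₁ ys∈′ = Product.map (false ∷_) id (∈-subseqs⁻ xs ys∈′)
... | inj₂ ys∈′ with _ , ys′∈ , refl ← ∈-map⁻ (x ∷_) ys∈′ =
  Product.map (true ∷_) (cong (x ∷_)) (∈-subseqs⁻ xs ys′∈)

select-all : (xs : List A) → select xs (replicate (length xs) true) ≡ xs
select-all []       = refl
select-all (x ∷ xs) = cong (x ∷_) (select-all xs)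

∈-subseqs-self : (xs : List A) → xs ∈ subseqs xs
∈-subseqs-self xs =
  subst (_∈ subseqs xs) (select-all xs) (∈-subseqs⁺ xs (replicate (length xs) true))

select-zeroV : (xs : List A) → select xs zeroV ≡ []
select-zeroV []       = refl
select-zeroV (x ∷ xs) = select-zeroV xs

select≡[]⇒≡zeroV : (xs : List A) (d : Vec Bool (length xs)) → select xs d ≡ [] → d ≡ zeroV
select≡[]⇒≡zeroV []       []          _   = refl
select≡[]⇒≡zeroV (x ∷ xs) (false ∷ d) sel = cong (false ∷_) (select≡[]⇒≡zeroV xs d sel)

select-sublist : (xs : List A) (d : Vec Bool (length xs)) → select xs d Sublist.⊆ xs
select-sublist []       []          = []
select-sublist (x ∷ xs) (true ∷ d)  = refl ∷ select-sublist xs d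
select-sublist (x ∷ xs) (false ∷ d) = x ∷ʳ select-sublist xs d

∈-subseqs⇒sublist : (xs : List A) {ys : List A} → ys ∈ subseqs xs → ys Sublist.⊆ xs
∈-subseqs⇒sublist xs ys∈ with d , refl ← ∈-subseqs⁻ xs ys∈ = select-sublist xs d

sumV-select : (xs : List (F2ⁿ r)) (d : Vec Bool (length xs)) →
  sumV (select xs d) ≡ combine d (Vec.fromList xs)
sumV-select []       []          = refl
sumV-select (x ∷ xs) (true ∷ d)  = cong (x ⊕_) (sumV-select xs d)
sumV-select (x ∷ xs) (false ∷ d) = trans (sumV-select xs d) (sym (⊕-identityˡ _))

-- Definitionally the test that `independent` applies to each subfamily.
nonDependency : List (F2ⁿ r) → Bool
nonDependency ys = if isNonEmpty ys then not ⌊ sumV ys ≟V zeroV ⌋ else true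

nonDependency≡true⇔ : (ys : List (F2ⁿ r)) →
  nonDependency ys ≡ true ⇔ (sumV ys ≡ zeroV → ys ≡ [])
nonDependency≡true⇔ []       = mk⇔ (λ _ _ → refl) (λ _ → refl)
nonDependency≡true⇔ (y ∷ ys) with sumV (y ∷ ys) ≟V zeroV
... | yes sum≡0 = mk⇔ (λ ()) (λ only-empty → contradiction (only-empty sum≡0) λ ())
... | no  sum≢0 = mk⇔ (λ _ sum≡0 → contradiction sum≡0 sum≢0) (λ _ → refl)

independent⇔IndependentRows : (xs : List (F2ⁿ r)) →
  independent xs ≡ true ⇔ IndependentRows (Vec.fromList xs)
independent⇔IndependentRows xs = mk⇔ to from
  where
  no-dependency⇔ = and-map≡true⇔ nonDependency (subseqs xs)
  to : independent xs ≡ true → IndependentRows (Vec.fromList xs)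
  to indep d comb≡0 = select≡[]⇒≡zeroV xs d (only-empty (trans (sumV-select xs d) comb≡0))
    where
    only-empty : sumV (select xs d) ≡ zeroV → select xs d ≡ []
    only-empty = Equivalence.to (nonDependency≡true⇔ (select xs d))
      (Equivalence.to no-dependency⇔ indep (∈-subseqs⁺ xs d))
  from : IndependentRows (Vec.fromList xs) → independent xs ≡ true
  from rows-indep = Equivalence.from no-dependency⇔ no-dependency
    where
    no-dependency : ∀ {ys} → ys ∈ subseqs xs → nonDependency ys ≡ true
    no-dependency ys∈ with d , refl ← ∈-subseqs⁻ xs ys∈ =
      Equivalence.from (nonDependency≡true⇔ (select xs d)) λ sum≡0 →
        trans (cong (select xs) (rows-indep d (trans (sym (sumV-select xs d)) sum≡0)))
              (select-zeroV xs)

maxL-lub : {b : ℕ} (ms : List ℕ) → (∀ {m} → m ∈ ms → m ≤ b) → maxL ms ≤ b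
maxL-lub ms ms≤b = foldr-preservesᵇ ⊔-lub z≤n (All.tabulate ms≤b)

∈⇒≤maxL : (ms : List ℕ) {m : ℕ} → m ∈ ms → m ≤ maxL ms
∈⇒≤maxL ms = All.lookup (foldr-forcesᵇ ⊔-split 0 ms ≤-refl)
  where
  ⊔-split = λ m n m⊔n≤ → m⊔n≤o⇒m≤o m n m⊔n≤ , m⊔n≤o⇒n≤o m n m⊔n≤

rank≡length⇔independent : (xs : List (F2ⁿ r)) → rank xs ≡ length xs ⇔ independent xs ≡ true
rank≡length⇔independent []          = mk⇔ (λ _ → refl) (λ _ → refl)
rank≡length⇔independent xs@(_ ∷ _) = mk⇔ to from
  where
  Independent? = λ (ys : List (F2ⁿ _)) → independent ys ≟ true
  lengths = List.map length (filter Independent? (subseqs xs))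
  to : rank xs ≡ length xs → independent xs ≡ true
  to rank≡length with foldr-selective ⊔-sel 0 lengths
  ... | inj₁ rank≡0 = contradiction (trans (sym rank≡length) rank≡0) λ ()
  ... | inj₂ rank∈ with ys , ys∈ , rank≡|ys| ← ∈-map⁻ length rank∈ =
    let ys∈subseqs , ys-indep = ∈-filter⁻ Independent? {xs = subseqs xs} ys∈
        |ys|≡|xs| = trans (sym rank≡|ys|) rank≡length
        ys≡xs = ≋⇒≡ (to-≋ |ys|≡|xs| (∈-subseqs⇒sublist xs ys∈subseqs))
    in subst (λ zs → independent zs ≡ true) ys≡xs ys-indep
  lengths≤ : ∀ {m} → m ∈ lengths → m ≤ length xs
  lengths≤ m∈ with ys , ys∈ , refl ← ∈-map⁻ length m∈ =
    length-mono-≤ (∈-subseqs⇒sublist xs (proj₁ (∈-filter⁻ Independent? {xs = subseqs xs} ys∈)))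
  from : independent xs ≡ true → rank xs ≡ length xs
  from indep = ≤-antisym (maxL-lub lengths lengths≤)
    (∈⇒≤maxL lengths (∈-map⁺ length (∈-filter⁺ Independent? (∈-subseqs-self xs) indep)))

-- Row spaces and monomial sums

combine-uncons : (c : F2ⁿ k) (G : Matrix k (suc n)) →
  combine c G ≡ dot c (column G zero) ∷ combine c (Vec.map Vec.tail G)
combine-uncons []          []            = refl
combine-uncons (true ∷ c)  ((a ∷ v) ∷ G) = cong ((a ∷ v) ⊕_) (combine-uncons c G)
combine-uncons (false ∷ c) ((a ∷ v) ∷ G) = cong (zeroV ⊕_) (combine-uncons c G)

column-map-tail : (G : Matrix k (suc n)) (j : Fin n) →
  column (Vec.map Vec.tail G) j ≡ column G (suc j)
column-map-tail []            j = refl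
column-map-tail ((a ∷ v) ∷ G) j = cong (lookup v j ∷_) (column-map-tail G j)

lookup-column : (G : Matrix k n) (j : Fin n) (i : Fin k) →
  lookup (column G j) i ≡ lookup (lookup G i) j
lookup-column (v ∷ G) j zero    = refl
lookup-column (v ∷ G) j (suc i) = lookup-column G j i

lookup-combine : (c : F2ⁿ k) (G : Matrix k n) (j : Fin n) →
  lookup (combine c G) j ≡ dot c (column G j)
lookup-combine c G zero    = cong (λ v → lookup v zero) (combine-uncons c G)
lookup-combine c G (suc j) = begin
  lookup (combine c G) (suc j)               ≡⟨ cong (λ v → lookup v (suc j)) (combine-uncons c G) ⟩
  lookup (combine c (Vec.map Vec.tail G)) j  ≡⟨ lookup-combine c (Vec.map Vec.tail G) j ⟩
  dot c (column (Vec.map Vec.tail G) j)      ≡⟨ cong (dot c) (column-map-tail G j) ⟩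
  dot c (column G (suc j))                   ∎
  where open ≡-Reasoning

evalMon-combine : (c : F2ⁿ k) (G : Matrix k n) (I : Subset n) →
  evalMon I (combine c G) ≡ andL (List.map (dot c) (subColumns G I))
evalMon-combine {n = zero}  c G []          with combine c G
... | [] = refl
evalMon-combine {n = suc n} c G (true ∷ I)  =
  trans (cong (evalMon (true ∷ I)) (combine-uncons c G))
        (cong (dot c (column G zero) ∧_) (evalMon-combine c (Vec.map Vec.tail G) I))
evalMon-combine {n = suc n} c G (false ∷ I) =
  trans (cong (evalMon (false ∷ I)) (combine-uncons c G))
        (evalMon-combine c (Vec.map Vec.tail G) I)

length-subColumns : (G : Matrix k n) (I : Subset n) → length (subColumns G I) ≡ ∣ I ∣
length-subColumns {n = zero}  G []          = refl
length-subColumns {n = suc n} G (true ∷ I)  = cong suc (length-subColumns (Vec.map Vec.tail G) I)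
length-subColumns {n = suc n} G (false ∷ I) = length-subColumns (Vec.map Vec.tail G) I

dot-unit : (c v : F2ⁿ k) (i : Fin k) →
  lookup v i ≡ true → (∀ i′ → i ≢ i′ → lookup v i′ ≡ false) → dot c v ≡ lookup c i
dot-unit (a ∷ c) (.true ∷ v) zero refl others = begin
  (a ∧ true) xor dot c v  ≡⟨ cong₂ _xor_ (∧-identityʳ a) (trans (cong (dot c) v≡0) (dot-zeroʳ c)) ⟩
  a xor false             ≡⟨ xor-identityʳ a ⟩
  a                       ∎
  where
  open ≡-Reasoning
  v≡0 : v ≡ zeroV
  v≡0 = lookup-ext (λ i′ → trans (others (suc i′) λ ()) (sym (lookup-replicate i′ false)))
dot-unit (a ∷ c) (b ∷ v) (suc i) vᵢ≡true others = begin
  (a ∧ b) xor dot c v      ≡⟨ cong (λ b → (a ∧ b) xor dot c v) (others zero λ ()) ⟩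
  (a ∧ false) xor dot c v  ≡⟨ cong (_xor dot c v) (∧-zeroʳ a) ⟩
  dot c v                  ≡⟨ dot-unit c v i vᵢ≡true others′ ⟩
  lookup c i               ∎
  where
  open ≡-Reasoning
  others′ : ∀ i′ → i ≢ i′ → lookup v i′ ≡ false
  others′ i′ i≢i′ = others (suc i′) (i≢i′ ∘ suc-injective)

IsRREF⇒combine-injective : (G : Matrix k n) → IsRREF G → Injective _≡_ _≡_ (λ c → combine c G)
IsRREF⇒combine-injective G (p , _ , pivot≡true , pivot-column , _) {c} {c′} cG≡c′G =
  lookup-ext λ i → begin
    lookup c i                          ≡⟨ at-pivot c i ⟨
    lookup (combine c G) (lookup p i)   ≡⟨ cong (λ v → lookup v (lookup p i)) cG≡c′G ⟩
    lookup (combine c′ G) (lookup p i)  ≡⟨ at-pivot c′ i ⟩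
    lookup c′ i                         ∎
  where
  open ≡-Reasoning
  at-pivot : ∀ c i → lookup (combine c G) (lookup p i) ≡ lookup c i
  at-pivot c i = trans (lookup-combine c G (lookup p i))
    (dot-unit c (column G (lookup p i)) i (trans (lookup-column G _ i) (pivot≡true i))
      (λ i′ i≢i′ → trans (lookup-column G _ i′) (pivot-column i i′ i≢i′)))

sumOver-rowSpan : (U : F2ⁿ n → Bool) (G : Matrix k n) → Injective _≡_ _≡_ (λ c → combine c G) →
  (∀ x → (U x ≡ true) ⇔ (x ∈RowSpan G)) → (m : Monomial n) →
  sumOver U m ≡ ∑ k (λ c → evalMon m (combine c G))
sumOver-rowSpan {n} {k} U G combine-inj U⇔span m = begin
  parity (List.map (evalMon m) (filter U? (allVecs n)))  ≡⟨ parity-↭ (↭.map⁺ (evalMon m) U↭image) ⟩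
  parity (List.map (evalMon m) image)                    ≡⟨ cong parity (map-∘ (allVecs k)) ⟨
  ∑ k (λ c → evalMon m (combine c G))                    ∎
  where
  open ≡-Reasoning
  U? = λ x → U x ≟ true
  image = List.map (λ c → combine c G) (allVecs k)
  in-U⇒in-image : ∀ {x} → x ∈ filter U? (allVecs n) → x ∈ image
  in-U⇒in-image {x} x∈U
    with c , refl ← Equivalence.to (U⇔span x) (proj₂ (∈-filter⁻ U? {xs = allVecs n} x∈U)) =
    ∈-map⁺ (λ c → combine c G) (∈-allVecs c)
  in-image⇒in-U : ∀ {x} → x ∈ image → x ∈ filter U? (allVecs n)
  in-image⇒in-U {x} x∈image with c , _ , refl ← ∈-map⁻ (λ c → combine c G) x∈image =
    ∈-filter⁺ U? (∈-allVecs x) (Equivalence.from (U⇔span x) (c , refl))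
  U↭image : filter U? (allVecs n) ↭ image
  U↭image = ∼bag⇒↭ (unique∧set⇒bag (Unique.filter⁺ U? (allVecs-unique n))
    (Unique.map⁺ combine-inj (allVecs-unique k)) (mk⇔ in-U⇒in-image in-image⇒in-U))

sumOver≡true⇔rank≡ : (I : Subset n) → ∣ I ∣ ≡ k → (U : F2ⁿ n → Bool) (G : Matrix k n) →
  IsRREF G → (∀ x → (U x ≡ true) ⇔ (x ∈RowSpan G)) →
  (sumOver U I ≡ true) ⇔ (rank (subColumns G I) ≡ k)
sumOver≡true⇔rank≡ {k = k} I |I|≡k U G rref U⇔span = begin
  sumOver U I ≡ true                          ≡⟨ cong (_≡ true) sumOver≡∑ ⟩
  ∑ k (λ c → allTrue (Vec.map (dot c) M)) ≡ true
                                              ∼⟨ ∑-allTrue⇔IndependentRows M |cols|≡k ⟩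
  IndependentRows M                           ∼⟨ Related.SK-sym (independent⇔IndependentRows cols) ⟩
  independent cols ≡ true                     ∼⟨ Related.SK-sym (rank≡length⇔independent cols) ⟩
  rank cols ≡ length cols                     ≡⟨ cong (rank cols ≡_) |cols|≡k ⟩
  rank cols ≡ k                               ∎
  where
  open Related.EquationalReasoning
  cols = subColumns G I
  M = Vec.fromList cols
  |cols|≡k = trans (length-subColumns G I) |I|≡k
  sumOver≡∑ : sumOver U I ≡ ∑ k (λ c → allTrue (Vec.map (dot c) M))
  sumOver≡∑ = trans (sumOver-rowSpan U G (IsRREF⇒combine-injective G rref) U⇔span I)
    (∑-cong λ c → trans (evalMon-combine c G I) (and-map≡allTrue (dot c) cols))

corollary4p4 : (n k t : ℕ) (ms : Vec (Monomial n) t) →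
    (∀ (i : Fin t) → ∣ Var (lookup ms i) ∣ ≡ k) →
    (U : F2ⁿ n → Bool) (G : Matrix k n) →
    IsRREF G → rank (allColumns G) ≡ k →
    (∀ (x : F2ⁿ n) → (U x ≡ true) ⇔ (x ∈RowSpan G)) →
    ((∀ (i : Fin t) → sumOver U (lookup ms i) ≡ true)
      ⇔ (∀ (i : Fin t) → rank (subColumns G (Var (lookup ms i))) ≡ k))
corollary4p4 n k t ms deg U G rref _ U⇔span = mk⇔
  (λ sums i → Equivalence.to (monomial i) (sums i))
  (λ ranks i → Equivalence.from (monomial i) (ranks i))
  where
  monomial : ∀ i → (sumOver U (lookup ms i) ≡ true) ⇔ (rank (subColumns G (lookup ms i)) ≡ k)
  monomial i = sumOver≡true⇔rank≡ (lookup ms i) (deg i) U G rref U⇔span
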